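{- With the convention that the empty partition $\emptyset$ has $|\emptyset|=0$, $l(\emptyset)=0$, $[p_\emptyset]_q=1$ and $[z_\emptyset]_q=1$, \[ E(t)=\sum_{n\ge0}e_nt^n=\sum_{\lambda}\varepsilon_\lambda[z_\lambda]_q^{ -1}[p_\lambda]_q\,t^{|\lambda|}, \] the sum being over all integer partitions $\lambda$.
   Context: Let $q$ be an indeterminate and $K$ a field containing $\mathbb{Q}(q)$; $\Lambda_K$ is the algebra of symmetric functions in $x_1,x_2,\dots$ over $K$, $e_n$ the elementary symmetric functions ($e_0=1$). $[n]_q=1+\cdots+q^{n-1}$ ($n\ge1$), $[0]_q=0$; $D_qF(t)=\frac{F(qt)-F(t)}{(q-1)t}$. The $q$-power sums $[p_n]_q$ are defined by $\sum_{n\ge1}[p_n]_q(-t)^{n-1}=D_qE(t)/E(t)$; $[p_\lambda]_q=[p_{\lambda_1}]_q\cdots[p_{\lambda_r}]_q$ for $\lambda=(\lambda_1,\dots,\lambda_r)$. $\varepsilon_\lambda=(-1)^{|\lambda|-l(\lambda)}$ where $|\lambda|$ is the sum and $l(\lambda)$ the number of parts. For a nonempty partition $\lambda=(\lambda_1,\dots,\lambda_r)$ of $n$, $[z_\lambda]_q^{ -1}=\sum_u\big([n]_q[n-u_1]_q[n-u_1-u_2]_q\cdots[n-u_1-\cdots-u_{r-1}]_q\big)^{ -1}$, summed over all distinct permutations $u=(u_1,\dots,u_r)$ of $(\lambda_1,\dots,\lambda_r)$. -}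

module Defs where

open import Level using (Level; _⊔_) renaming (suc to lsuc)
open import Data.Nat using (ℕ; zero; suc; _∸_; _≤ᵇ_)
open import Data.Bool using (Bool; true; false; _∧_; if_then_else_)
open import Data.List using (List; []; _∷_; _++_; map; concatMap; filterᵇ; length; foldr)
open import Data.Nat.ListAction using (sum)
open import Data.List.Properties using (≡-dec)
open import Data.Integer using (ℤ; +_; -[1+_])
open import Relation.Nullary using (¬_; does)
open import Algebra.Bundles using (CommutativeRing)
open import Algebra.Morphism.Structures using (module RingMorphisms)
import Data.Nat as ℕ

record Field (c ℓ : Level) : Set (lsuc (c ⊔ ℓ)) where
  field
    commutativeRing : CommutativeRing c ℓ
  open CommutativeRing commutativeRing public
  field
    _⁻¹     : Carrier → Carrier
    0≉1     : ¬ (0# ≈ 1#)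
    inverse : ∀ x → ¬ (x ≈ 0#) → (x * (x ⁻¹)) ≈ 1#

module RingOps {c ℓ : Level} (R : CommutativeRing c ℓ) where
  open CommutativeRing R

  natR : ℕ → Carrier
  natR zero    = 0#
  natR (suc n) = 1# + natR n

  intR : ℤ → Carrier
  intR (+ n)      = natR n
  intR -[1+ n ]   = - natR (suc n)

  evalℤ : List ℤ → Carrier → Carrier
  evalℤ []       x = 0#
  evalℤ (c ∷ cs) x = intR c + x * evalℤ cs x

  sumR : List Carrier → Carrier
  sumR = foldr _+_ 0#

  prodR : List Carrier → Carrier
  prodR = foldr _*_ 1#

  signR : ℕ → Carrier
  signR zero    = 1#
  signR (suc n) = - signR n

  -- q-integers [n]_q = 1 + q + … + q^{n-1}, [0]_q = 0
  qint : Carrier → ℕ → Carrier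
  qint q zero    = 0#
  qint q (suc n) = 1# + q * qint q n

NonZeroPoly : List ℤ → Set
NonZeroPoly []       = Data.Empty.⊥ where import Data.Empty
NonZeroPoly (c ∷ cs) = ¬ (c Relation.Binary.PropositionalEquality.≡ + 0) Data.Sum.⊎ NonZeroPoly cs
  where import Data.Sum
        import Relation.Binary.PropositionalEquality

-- q ∈ K generates a copy of ℚ(q) (q an indeterminate): no nonzero integer
-- polynomial vanishes at q (this also forces characteristic 0, via the
-- constant polynomials).  For a field K this is exactly "ℚ(q) ⊆ K".
Transcendental : {c ℓ : Level} (K : Field c ℓ) → Field.Carrier K → Set ℓ
Transcendental K q = ∀ (cs : List ℤ) → NonZeroPoly cs →
  ¬ (evalℤ cs q ≈ 0#)
  where open Field K
        open RingOps commutativeRing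

compositions : ℕ → List (List ℕ)
compositions zero    = [] ∷ []
compositions (suc n) = map (1 ∷_) (compositions n) ++ concatMap bump (compositions n)
  where
  bump : List ℕ → List (List ℕ)
  bump []       = []
  bump (a ∷ as) = (suc a ∷ as) ∷ []

nonIncreasing : List ℕ → Bool
nonIncreasing []           = true
nonIncreasing (a ∷ [])     = true
nonIncreasing (a ∷ b ∷ as) = (b ≤ᵇ a) ∧ nonIncreasing (b ∷ as)

partitions : ℕ → List (List ℕ)
partitions n = filterᵇ nonIncreasing (compositions n)

insertDesc : ℕ → List ℕ → List ℕ
insertDesc x []       = x ∷ []
insertDesc x (y ∷ ys) = if y ≤ᵇ x then x ∷ y ∷ ys else y ∷ insertDesc x ys

sortDesc : List ℕ → List ℕ
sortDesc []       = []
sortDesc (x ∷ xs) = insertDesc x (sortDesc xs)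

distinctPerms : List ℕ → List (List ℕ)
distinctPerms λ′ = filterᵇ (λ u → does (≡-dec ℕ._≟_ (sortDesc u) λ′)) (compositions (sum λ′))

module QPartition {c ℓ : Level} (K : Field c ℓ) (q : Field.Carrier K) where
  open Field K
  open RingOps commutativeRing

  -- ([n]_q [n-u₁]_q ⋯ [n-u₁-⋯-u_{r-1}]_q)⁻¹, written as the product of inverses
  zTerm : ℕ → List ℕ → Carrier
  zTerm n []       = 1#
  zTerm n (u ∷ us) = (qint q n ⁻¹) * zTerm (n ∸ u) us

  zInv : List ℕ → Carrier
  zInv []         = 1#
  zInv (l ∷ ls)   = sumR (map (zTerm (sum (l ∷ ls))) (distinctPerms (l ∷ ls)))

  ε : List ℕ → Carrier
  ε λ′ = signR (sum λ′ ∸ length λ′)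

-- Power-series data in a commutative K-algebra A (given by a ring map ι : K → A)

module QSeries {c ℓ a ℓa : Level} (K : Field c ℓ) (q : Field.Carrier K)
               (A : CommutativeRing a ℓa) (ι : Field.Carrier K → CommutativeRing.Carrier A) where
  open CommutativeRing A
  open RingOps A
  private module KR = RingOps (Field.commutativeRing K)

  -- coefficient of t^m in F(t)·G(t) for F = Σ f_n tⁿ, G = Σ g_n tⁿ
  conv : (ℕ → Carrier) → (ℕ → Carrier) → ℕ → Carrier
  conv f g m = sumR (map (λ k → f k * g (m ∸ k)) (Data.List.upTo (suc m)))
    where import Data.List

  -- coefficient of t^m in D_q F(t) = (F(qt) - F(t)) / ((q-1)t), i.e. [m+1]_q f_{m+1}
  Dq : (ℕ → Carrier) → ℕ → Carrier
  Dq f m = ι (KR.qint q (suc m)) * f (suc m)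

  -- coefficient of t^k in Σ_{n≥1} p_n (-t)^{n-1}
  pSeries : (ℕ → Carrier) → ℕ → Carrier
  pSeries p k = signR k * p (suc k)

  pPart : (ℕ → Carrier) → List ℕ → Carrier
  pPart p λ′ = prodR (map p λ′)

-- Write E(t) = Σ e_n tⁿ and P(t) = Σ [p_{k+1}]_q (-t)^k.  The hypothesis D_q E = P·E says
-- [m+1]_q e_{m+1} = Σ_{k ≤ m} (-1)^k [p_{k+1}]_q e_{m-k}; since q is transcendental,
-- [m+1]_q is invertible, so with e₀ = 1 this recursion determines e.  Its solution is the
-- sum over all compositions u of n of
--   (-1)^{n - l(u)} ([n]_q [n-u₁]_q ⋯)⁻¹ [p_u]_q,
-- as one sees by splitting off the first part u₁ = k+1.  Finally every composition sorts to
-- exactly one partition λ, and the compositions sorting to λ are the distinct permutations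
-- of λ, so grouping the compositions by their sorted form gives the sum over partitions.

module Submission where

open import Defs
open import Algebra.Bundles using (CommutativeRing)
open import Algebra.Morphism.Structures using (module RingMorphisms)
open import Algebra.Properties.CommutativeSemigroup using (interchange; x∙yz≈y∙xz)
import Algebra.Properties.Ring as RingProperties
open import Data.Bool using (Bool; T; T?; true; false; if_then_else_)
open import Data.Bool.Properties using (T-∧)
open import Data.Empty using (⊥-elim)
import Data.Integer as ℤ
open import Data.List using (List; map; []; _∷_; _++_; concatMap; filterᵇ; length; upTo; replicate)
open import Data.List.Properties using (≡-dec; map-∘; map-upTo; map-applyUpTo)
open import Data.List.Relation.Binary.Permutation.Propositional using (_↭_; ↭-sym; ↭⇒↭ₛ′)
open import Data.List.Relation.Binary.Permutation.Propositional.Properties using (All-resp-↭; ↭-length; map⁺)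
open import Data.List.Relation.Binary.Permutation.Setoid.Properties using (foldr-commMonoid)
open import Data.List.Relation.Unary.All as All using (All; []; _∷_)
open import Data.List.Relation.Unary.All.Properties using (++⁺; concat⁺; all-filter; filter⁺)
import Data.List.Relation.Unary.All.Properties as Allₚ
open import Data.List.Relation.Unary.Linked using (Linked; []; [-]; _∷_)
open import Data.Nat using (ℕ; zero; suc; _∸_; _≤_; _<_; _≥_; z≤n; s≤s)
import Data.Nat as ℕ
open import Data.Nat.Induction using (<-rec)
open import Data.Nat.ListAction using (sum)
open import Data.Nat.ListAction.Properties using (sum-↭)
open import Data.Nat.Properties using (≤-decTotalOrder; ≤⇒≤ᵇ; +-mono-≤; +-∸-assoc; m∸n≤m; suc-injective)
open import Data.Product using (_×_; _,_; proj₁; proj₂)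
open import Data.Sum using (inj₁)
open import Data.Unit using (tt)
open import Function using (_∘_)
open import Function.Bundles using (Equivalence)
open import Level using (Level)
open import Relation.Binary.Definitions using (DecidableEquality)
open import Relation.Binary.PropositionalEquality as ≡ using (_≡_; refl)
open import Relation.Nullary using (¬_; Dec; does; yes; no)
open import Relation.Binary.Properties.DecTotalOrder ≤-decTotalOrder using (≥-decTotalOrder)
open import Data.List.Sort.InsertionSort.Base ≥-decTotalOrder using (insert; sort)
open import Data.List.Sort.InsertionSort.Properties ≥-decTotalOrder using (sort-↭; sort-↗)

_≟ₗ_ : DecidableEquality (List ℕ)
_≟ₗ_ = ≡-dec ℕ._≟_

T-does⇒ : ∀ {a} {A : Set a} (d : Dec A) → T (does d) → A
T-does⇒ (yes a) _ = a

sortDesc≡sort : ∀ u → sortDesc u ≡ sort u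
sortDesc≡sort []      = refl
sortDesc≡sort (x ∷ u) rewrite sortDesc≡sort u = insertDesc≡insert x (sort u)
  where
  insertDesc≡insert : ∀ x ys → insertDesc x ys ≡ insert x ys
  insertDesc≡insert x []       = refl
  insertDesc≡insert x (y ∷ ys) rewrite insertDesc≡insert x ys = refl

sortDesc-↭ : ∀ u → sortDesc u ↭ u
sortDesc-↭ u rewrite sortDesc≡sort u = sort-↭ u

linked-≥⇒nonIncreasing : ∀ {xs} → Linked _≥_ xs → T (nonIncreasing xs)
linked-≥⇒nonIncreasing []        = tt
linked-≥⇒nonIncreasing [-]       = tt
linked-≥⇒nonIncreasing (y≤x ∷ s) =
  Equivalence.from T-∧ (≤⇒≤ᵇ y≤x , linked-≥⇒nonIncreasing s)

sortDesc-nonIncreasing : ∀ u → T (nonIncreasing (sortDesc u))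
sortDesc-nonIncreasing u rewrite sortDesc≡sort u = linked-≥⇒nonIncreasing (sort-↗ u)

Positive : List ℕ → Set
Positive = All (0 <_)

length≤sum : ∀ {u} → Positive u → length u ≤ sum u
length≤sum []         = z≤n
length≤sum (x>0 ∷ pu) = +-mono-≤ x>0 (length≤sum pu)

IsComposition : ℕ → List ℕ → Set
IsComposition n u = Positive u × sum u ≡ n

compositions-sound : ∀ n → All (IsComposition n) (compositions n)
compositions-sound zero    = ([] , refl) ∷ []
compositions-sound (suc n) =
  ++⁺ (Allₚ.map⁺ (All.map (λ (pu , Σu) → (s≤s z≤n ∷ pu) , ≡.cong suc Σu) (compositions-sound n)))
      (concat⁺ (Allₚ.map⁺ (All.map bump-sound (compositions-sound n))))
  where
  -- `_` is the local bump of compositions, which Defs does not export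
  bump-sound : ∀ {u} → IsComposition n u → All (IsComposition (suc n)) _
  bump-sound {[]}    _                = []
  bump-sound {_ ∷ _} ((_ ∷ pas) , Σu) = ((s≤s z≤n ∷ pas) , ≡.cong suc Σu) ∷ []

partitions-sum : ∀ n → All (λ l → sum l ≡ n) (partitions n)
partitions-sum n = filter⁺ (T? ∘ nonIncreasing) (All.map proj₂ (compositions-sound n))

module ListSums {c ℓ : Level} (R : CommutativeRing c ℓ) where
  open CommutativeRing R renaming (refl to ≈-refl)
  open RingOps R
  open import Relation.Binary.Reasoning.Setoid setoid

  private variable X Y : Set

  ∑ : List X → (X → Carrier) → Carrier
  ∑ xs f = sumR (map f xs)

  syntax ∑ xs (λ x → e) = ∑[ x ∈ xs ] e

  ∑-congᴬ : ∀ {f g : X → Carrier} {xs} → All (λ x → f x ≈ g x) xs → ∑ xs f ≈ ∑ xs g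
  ∑-congᴬ []           = ≈-refl
  ∑-congᴬ (fx≈gx ∷ ps) = +-cong fx≈gx (∑-congᴬ ps)

  ∑-cong : ∀ {f g : X → Carrier} xs → (∀ x → f x ≈ g x) → ∑ xs f ≈ ∑ xs g
  ∑-cong []       f≈g = ≈-refl
  ∑-cong (x ∷ xs) f≈g = +-cong (f≈g x) (∑-cong xs f≈g)

  ∑-0 : (xs : List X) → ∑[ x ∈ xs ] 0# ≈ 0#
  ∑-0 []       = ≈-refl
  ∑-0 (x ∷ xs) = trans (+-congˡ (∑-0 xs)) (+-identityʳ 0#)

  ∑-++ : ∀ (f : X → Carrier) xs ys → ∑ (xs ++ ys) f ≈ ∑ xs f + ∑ ys f
  ∑-++ f []       ys = sym (+-identityˡ _)
  ∑-++ f (x ∷ xs) ys = trans (+-congˡ (∑-++ f xs ys)) (sym (+-assoc _ _ _))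

  ∑-map : ∀ (g : X → Y) (f : Y → Carrier) xs → ∑ (map g xs) f ≡ ∑[ x ∈ xs ] f (g x)
  ∑-map g f xs = ≡.cong sumR (≡.sym (map-∘ xs))

  ∑-concatMap : ∀ (g : X → List Y) (f : Y → Carrier) xs → ∑ (concatMap g xs) f ≈ ∑[ x ∈ xs ] ∑ (g x) f
  ∑-concatMap g f []       = ≈-refl
  ∑-concatMap g f (x ∷ xs) = trans (∑-++ f (g x) _) (+-congˡ (∑-concatMap g f xs))

  ∑-+ : ∀ (f g : X → Carrier) xs → ∑[ x ∈ xs ] (f x + g x) ≈ ∑ xs f + ∑ xs g
  ∑-+ f g []       = sym (+-identityʳ 0#)
  ∑-+ f g (x ∷ xs) = trans (+-congˡ (∑-+ f g xs)) (interchange +-commutativeSemigroup _ _ _ _)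

  *-distribˡ-∑ : ∀ a (f : X → Carrier) xs → a * ∑ xs f ≈ ∑[ x ∈ xs ] (a * f x)
  *-distribˡ-∑ a f []       = zeroʳ a
  *-distribˡ-∑ a f (x ∷ xs) = trans (distribˡ a _ _) (+-congˡ (*-distribˡ-∑ a f xs))

  *-distribʳ-∑ : ∀ a (f : X → Carrier) xs → ∑ xs f * a ≈ ∑[ x ∈ xs ] (f x * a)
  *-distribʳ-∑ a f []       = zeroˡ a
  *-distribʳ-∑ a f (x ∷ xs) = trans (distribʳ a _ _) (+-congˡ (*-distribʳ-∑ a f xs))

  ∑-filterᵇ : ∀ (P : X → Bool) (f : X → Carrier) xs →
    ∑ (filterᵇ P xs) f ≈ ∑[ x ∈ xs ] (if P x then f x else 0#)
  ∑-filterᵇ P f []       = ≈-refl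
  ∑-filterᵇ P f (x ∷ xs) with P x
  ... | true  = +-congˡ (∑-filterᵇ P f xs)
  ... | false = trans (∑-filterᵇ P f xs) (sym (+-identityˡ _))

  ∑-swap : ∀ (f : X → Y → Carrier) xs ys →
    ∑[ x ∈ xs ] ∑[ y ∈ ys ] f x y ≈ ∑[ y ∈ ys ] ∑[ x ∈ xs ] f x y
  ∑-swap f []       ys = sym (∑-0 ys)
  ∑-swap f (x ∷ xs) ys = trans (+-congˡ (∑-swap f xs ys)) (sym (∑-+ (f x) _ ys))

  ∑-upTo-suc : ∀ n (f : ℕ → Carrier) → ∑[ k ∈ upTo (suc n) ] f k ≡ f 0 + ∑[ k ∈ upTo n ] f (suc k)
  ∑-upTo-suc n f = ≡.cong (λ fs → f 0 + sumR fs)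
    (≡.trans (map-applyUpTo suc f n) (≡.sym (map-upTo (f ∘ suc) n)))

  signR-+ : ∀ k j → signR (k ℕ.+ j) ≈ signR k * signR j
  signR-+ zero    j = sym (*-identityˡ _)
  signR-+ (suc k) j = trans (-‿cong (signR-+ k j)) (RingProperties.-‿distribˡ-* ring (signR k) (signR j))

  convolution-recursion-unique : ∀ (a c x y : ℕ → Carrier) → x 0 ≈ y 0 →
    (∀ m → x (suc m) ≈ c m * ∑[ k ∈ upTo (suc m) ] (a k * x (m ∸ k))) →
    (∀ m → y (suc m) ≈ c m * ∑[ k ∈ upTo (suc m) ] (a k * y (m ∸ k))) →
    ∀ n → x n ≈ y n
  convolution-recursion-unique a c x y x₀≈y₀ x-rec y-rec = <-rec (λ n → x n ≈ y n) step
    where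
    step : ∀ n → (∀ {i} → i < n → x i ≈ y i) → x n ≈ y n
    step zero    _  = x₀≈y₀
    step (suc m) ih = begin
      x (suc m)                                      ≈⟨ x-rec m ⟩
      c m * ∑[ k ∈ upTo (suc m) ] (a k * x (m ∸ k))  ≈⟨ *-congˡ (∑-cong (upTo (suc m)) λ k →
                                                          *-congˡ (ih (s≤s (m∸n≤m m k)))) ⟩
      c m * ∑[ k ∈ upTo (suc m) ] (a k * y (m ∸ k))  ≈⟨ y-rec m ⟨
      y (suc m)                                      ∎

module CompositionSums {c ℓ : Level} (R : CommutativeRing c ℓ) where
  open CommutativeRing R renaming (refl to ≈-refl)
  open ListSums R
  open import Relation.Binary.Reasoning.Setoid setoid

  -- mirrors the second half of the definition of compositions (suc n)
  bumpFirst : (List ℕ → Carrier) → List ℕ → Carrier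
  bumpFirst F []       = 0#
  bumpFirst F (a ∷ as) = F (suc a ∷ as)

  ∑-compositions-split : ∀ n (F : List ℕ → Carrier) →
    ∑ (compositions (suc n)) F ≈ ∑[ u ∈ compositions n ] F (1 ∷ u) + ∑ (compositions n) (bumpFirst F)
  ∑-compositions-split n F = begin
    ∑ (compositions (suc n)) F
      ≈⟨ ∑-++ F (map (1 ∷_) (compositions n)) _ ⟩
    ∑ (map (1 ∷_) (compositions n)) F + ∑ (concatMap _ (compositions n)) F
      ≈⟨ +-cong (reflexive (∑-map (1 ∷_) F (compositions n)))
                (trans (∑-concatMap _ F (compositions n))
                       (∑-cong (compositions n) λ { [] → ≈-refl ; (_ ∷ _) → +-identityʳ _ })) ⟩
    ∑[ u ∈ compositions n ] F (1 ∷ u) + ∑ (compositions n) (bumpFirst F) ∎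

  ∑-compositions-suc : ∀ m (F : List ℕ → Carrier) →
    ∑ (compositions (suc m)) F ≈ ∑[ k ∈ upTo (suc m) ] ∑[ u ∈ compositions (m ∸ k) ] F (suc k ∷ u)
  ∑-compositions-suc zero    F = trans (∑-compositions-split 0 F) (+-congˡ (+-identityʳ 0#))
  ∑-compositions-suc (suc m) F = begin
    ∑ (compositions (suc (suc m))) F
      ≈⟨ ∑-compositions-split (suc m) F ⟩
    ∑[ u ∈ compositions (suc m) ] F (1 ∷ u) + ∑ (compositions (suc m)) (bumpFirst F)
      ≈⟨ +-congˡ (∑-compositions-suc m (bumpFirst F)) ⟩
    ∑[ u ∈ compositions (suc m) ] F (1 ∷ u)
      + ∑[ k ∈ upTo (suc m) ] ∑[ u ∈ compositions (m ∸ k) ] F (suc (suc k) ∷ u)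
      ≡⟨ ∑-upTo-suc (suc m) (λ k → ∑[ u ∈ compositions (suc m ∸ k) ] F (suc k ∷ u)) ⟨
    ∑[ k ∈ upTo (suc (suc m)) ] ∑[ u ∈ compositions (suc m ∸ k) ] F (suc k ∷ u) ∎

  -- Kronecker-delta form of: a composition c of n occurs exactly once in compositions n.
  ∑-δ-compositions : ∀ {n c} x → IsComposition n c →
    ∑[ l ∈ compositions n ] (if does (c ≟ₗ l) then x else 0#) ≈ x
  ∑-δ-compositions {zero}  {[]}    x _ = +-identityʳ x
  ∑-δ-compositions {zero}  {_ ∷ _} x (s≤s z≤n ∷ _ , ())
  ∑-δ-compositions {suc n} {[]}    x (_ , ())
  ∑-δ-compositions {_}     {0 ∷ _} x (() ∷ _ , _)
  ∑-δ-compositions {suc n} {1 ∷ c} x (_ ∷ pc , Σc) = begin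
    ∑[ l ∈ compositions (suc n) ] (if does ((1 ∷ c) ≟ₗ l) then x else 0#)
      ≈⟨ ∑-compositions-split n _ ⟩
    ∑[ l ∈ compositions n ] (if does (c ≟ₗ l) then x else 0#) + ∑ (compositions n) (bumpFirst _)
      ≈⟨ +-cong (∑-δ-compositions x (pc , suc-injective Σc))
                (trans (∑-congᴬ (All.map bump≈0 (compositions-sound n))) (∑-0 (compositions n))) ⟩
    x + 0#
      ≈⟨ +-identityʳ x ⟩
    x ∎
    where
    bump≈0 : ∀ {u} → IsComposition n u → bumpFirst (λ l → if does ((1 ∷ c) ≟ₗ l) then x else 0#) u ≈ 0#
    bump≈0 {[]}        _              = ≈-refl
    bump≈0 {suc _ ∷ _} _              = ≈-refl
    bump≈0 {zero ∷ _}  ((() ∷ _) , _)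
  ∑-δ-compositions {suc n} {suc (suc a) ∷ c} x (_ ∷ pc , Σc) = begin
    ∑[ l ∈ compositions (suc n) ] (if does ((suc (suc a) ∷ c) ≟ₗ l) then x else 0#)
      ≈⟨ ∑-compositions-split n _ ⟩
    ∑[ u ∈ compositions n ] 0# + ∑ (compositions n) (bumpFirst _)
      ≈⟨ +-cong (∑-0 (compositions n)) (∑-cong (compositions n) bump≈δ) ⟩
    0# + ∑[ l ∈ compositions n ] (if does ((suc a ∷ c) ≟ₗ l) then x else 0#)
      ≈⟨ +-identityˡ _ ⟩
    ∑[ l ∈ compositions n ] (if does ((suc a ∷ c) ≟ₗ l) then x else 0#)
      ≈⟨ ∑-δ-compositions x ((s≤s z≤n ∷ pc) , suc-injective Σc) ⟩
    x ∎
    where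
    bump≈δ : ∀ u → bumpFirst (λ l → if does ((suc (suc a) ∷ c) ≟ₗ l) then x else 0#) u
                   ≈ (if does ((suc a ∷ c) ≟ₗ u) then x else 0#)
    bump≈δ []      = ≈-refl
    bump≈δ (_ ∷ _) = ≈-refl

  ∑-δ-partitions : ∀ {n c} x → IsComposition n c → T (nonIncreasing c) →
    ∑[ l ∈ partitions n ] (if does (c ≟ₗ l) then x else 0#) ≈ x
  ∑-δ-partitions {n} {c} x comp-c c↘ = begin
    ∑[ l ∈ partitions n ] (if does (c ≟ₗ l) then x else 0#)
      ≈⟨ ∑-filterᵇ nonIncreasing _ (compositions n) ⟩
    ∑[ l ∈ compositions n ] (if nonIncreasing l then (if does (c ≟ₗ l) then x else 0#) else 0#)
      ≈⟨ ∑-cong (compositions n) drop-nonIncreasing ⟩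
    ∑[ l ∈ compositions n ] (if does (c ≟ₗ l) then x else 0#)
      ≈⟨ ∑-δ-compositions x comp-c ⟩
    x ∎
    where
    drop-nonIncreasing : ∀ l →
      (if nonIncreasing l then (if does (c ≟ₗ l) then x else 0#) else 0#) ≈ (if does (c ≟ₗ l) then x else 0#)
    drop-nonIncreasing l with c ≟ₗ l | nonIncreasing l in eq
    ... | yes refl | true  = ≈-refl
    ... | yes refl | false = ⊥-elim (≡.subst T eq c↘)
    ... | no _     | true  = ≈-refl
    ... | no _     | false = ≈-refl

module _ {c ℓ : Level} (K : Field c ℓ) (q : Field.Carrier K) where
  open Field K renaming (refl to ≈-refl)
  open RingOps commutativeRing

  qint≈evalℤ : ∀ n → qint q n ≈ evalℤ (replicate n (ℤ.+ 1)) q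
  qint≈evalℤ zero    = ≈-refl
  qint≈evalℤ (suc n) = +-cong (sym (+-identityʳ 1#)) (*-congˡ (qint≈evalℤ n))

  qint-suc≉0 : Transcendental K q → ∀ n → ¬ (qint q (suc n) ≈ 0#)
  qint-suc≉0 q-tr n [n+1]≈0 =
    q-tr (replicate (suc n) (ℤ.+ 1)) (inj₁ (λ ())) (trans (sym (qint≈evalℤ (suc n))) [n+1]≈0)

module FieldHomomorphism {c ℓ a ℓa : Level} (K : Field c ℓ)
  (A : CommutativeRing a ℓa) (ι : Field.Carrier K → CommutativeRing.Carrier A)
  (ι-hom : RingMorphisms.IsRingHomomorphism
             (CommutativeRing.rawRing (Field.commutativeRing K)) (CommutativeRing.rawRing A) ι) where

  private
    module K where
      open Field K public
      open RingOps commutativeRing public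
      open ListSums commutativeRing public
    module ι = RingMorphisms.IsRingHomomorphism ι-hom
  open CommutativeRing A
  open RingOps A
  open ListSums A
  open import Relation.Binary.Reasoning.Setoid setoid

  ι-∑ : ∀ {X : Set} (f : X → K.Carrier) xs → ι (K.∑ xs f) ≈ ∑[ x ∈ xs ] ι (f x)
  ι-∑ f []       = ι.0#-homo
  ι-∑ f (x ∷ xs) = trans (ι.+-homo _ _) (+-congˡ (ι-∑ f xs))

  ι-signR : ∀ k → ι (K.signR k) ≈ signR k
  ι-signR zero    = ι.1#-homo
  ι-signR (suc k) = trans (ι.-‿homo _) (-‿cong (ι-signR k))

  ι-inverse : ∀ {x} → ¬ (x K.≈ K.0#) → ι (x K.⁻¹) * ι x ≈ 1#
  ι-inverse {x} x≉0 = begin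
    ι (x K.⁻¹) * ι x   ≈⟨ ι.*-homo _ _ ⟨
    ι (x K.⁻¹ K.* x)   ≈⟨ ι.⟦⟧-cong (K.trans (K.*-comm _ _) (K.inverse x x≉0)) ⟩
    ι K.1#             ≈⟨ ι.1#-homo ⟩
    1#                 ∎

module Expansion {c ℓ a ℓa : Level} (K : Field c ℓ) (q : Field.Carrier K)
  (A : CommutativeRing a ℓa) (ι : Field.Carrier K → CommutativeRing.Carrier A)
  (ι-hom : RingMorphisms.IsRingHomomorphism
             (CommutativeRing.rawRing (Field.commutativeRing K)) (CommutativeRing.rawRing A) ι)
  (p : ℕ → CommutativeRing.Carrier A) where

  private
    module K where
      open Field K public
      open RingOps commutativeRing public
      open ListSums commutativeRing public
    module ι = RingMorphisms.IsRingHomomorphism ι-hom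
  open CommutativeRing A renaming (refl to ≈-refl)
  open RingOps A
  open ListSums A
  open CompositionSums A
  open FieldHomomorphism K A ι ι-hom
  open QPartition K q
  open QSeries K q A ι
  open import Relation.Binary.Reasoning.Setoid setoid

  ε-sortDesc : ∀ u → ε (sortDesc u) ≡ ε u
  ε-sortDesc u = ≡.cong₂ (λ s l → K.signR (s ∸ l)) (sum-↭ (sortDesc-↭ u)) (↭-length (sortDesc-↭ u))

  ε-cons : ∀ k {u} → Positive u → ε (suc k ∷ u) K.≈ K.signR k K.* ε u
  ε-cons k {u} pu =
    K.trans (K.reflexive (≡.cong K.signR (+-∸-assoc k (length≤sum pu)))) (K.signR-+ k _)

  pPart-sortDesc : ∀ u → pPart p (sortDesc u) ≈ pPart p u
  pPart-sortDesc u =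
    foldr-commMonoid setoid *-isCommutativeMonoid (↭⇒↭ₛ′ isEquivalence (map⁺ p (sortDesc-↭ u)))

  -- the summand of ε_λ [z_λ]_q⁻¹ [p_λ]_q indexed by a distinct permutation u of λ
  term : ℕ → List ℕ → Carrier
  term n u = ι (ε u K.* zTerm n u) * pPart p u

  expansion : ℕ → Carrier
  expansion n = ∑[ u ∈ compositions n ] term n u

  partitionTerm : List ℕ → Carrier
  partitionTerm l = ι (ε l K.* zInv l) * pPart p l

  zInv≈∑ : ∀ l → zInv l K.≈ K.∑[ u ∈ distinctPerms l ] zTerm (sum l) u
  zInv≈∑ []      = K.sym (K.+-identityʳ K.1#)
  zInv≈∑ (_ ∷ _) = K.refl

  term-sorted : ∀ n {u l} → sortDesc u ≡ l → ι (ε l K.* zTerm n u) * pPart p l ≈ term n u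
  term-sorted n {u} refl = *-cong (ι.⟦⟧-cong (K.*-congʳ (K.reflexive (ε-sortDesc u)))) (pPart-sortDesc u)

  partitionTerm-expand : ∀ l {n} → sum l ≡ n →
    partitionTerm l ≈ ∑[ u ∈ compositions n ] (if does (sortDesc u ≟ₗ l) then term n u else 0#)
  partitionTerm-expand l refl = begin
    ι (ε l K.* zInv l) * pPart p l
      ≈⟨ *-congʳ (ι.⟦⟧-cong (K.trans (K.*-congˡ (zInv≈∑ l)) (K.*-distribˡ-∑ (ε l) _ perms))) ⟩
    ι (K.∑[ u ∈ perms ] (ε l K.* zTerm (sum l) u)) * pPart p l
      ≈⟨ trans (*-congʳ (ι-∑ _ perms)) (*-distribʳ-∑ _ _ perms) ⟩
    ∑[ u ∈ perms ] (ι (ε l K.* zTerm (sum l) u) * pPart p l)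
      ≈⟨ ∑-congᴬ (All.map (λ {u} t → term-sorted (sum l) {u} (T-does⇒ (sortDesc u ≟ₗ l) t))
                          (all-filter (T? ∘ λ u → does (sortDesc u ≟ₗ l)) (compositions (sum l)))) ⟩
    ∑[ u ∈ perms ] term (sum l) u
      ≈⟨ ∑-filterᵇ _ _ (compositions (sum l)) ⟩
    ∑[ u ∈ compositions (sum l) ] (if does (sortDesc u ≟ₗ l) then term (sum l) u else 0#) ∎
    where perms = distinctPerms l

  ∑-partitions≈expansion : ∀ n → ∑[ l ∈ partitions n ] partitionTerm l ≈ expansion n
  ∑-partitions≈expansion n = begin
    ∑[ l ∈ partitions n ] partitionTerm l
      ≈⟨ ∑-congᴬ (All.map (partitionTerm-expand _) (partitions-sum n)) ⟩
    ∑[ l ∈ partitions n ] ∑[ u ∈ compositions n ] (if does (sortDesc u ≟ₗ l) then term n u else 0#)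
      ≈⟨ ∑-swap _ (partitions n) (compositions n) ⟩
    ∑[ u ∈ compositions n ] ∑[ l ∈ partitions n ] (if does (sortDesc u ≟ₗ l) then term n u else 0#)
      ≈⟨ ∑-congᴬ (All.map sorted-occurs-once (compositions-sound n)) ⟩
    expansion n ∎
    where
    sorted-occurs-once : ∀ {u} → IsComposition n u →
      ∑[ l ∈ partitions n ] (if does (sortDesc u ≟ₗ l) then term n u else 0#) ≈ term n u
    sorted-occurs-once {u} (pu , Σu) =
      ∑-δ-partitions (term n u)
        (All-resp-↭ (↭-sym (sortDesc-↭ u)) pu , ≡.trans (sum-↭ (sortDesc-↭ u)) Σu) (sortDesc-nonIncreasing u)

  expansion-zero : expansion 0 ≈ 1#
  expansion-zero = trans (+-identityʳ _) (trans (*-identityʳ _) (trans (ι.⟦⟧-cong (K.*-identityʳ _)) ι.1#-homo))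

  term-cons : ∀ m k {u} → Positive u →
    term (suc m) (suc k ∷ u) ≈ ι (K.qint q (suc m) K.⁻¹) * (pSeries p k * term (m ∸ k) u)
  term-cons m k {u} pu = begin
    ι (ε (suc k ∷ u) K.* (iq K.* z)) * (p (suc k) * pPart p u)
      ≈⟨ *-congʳ (ι.⟦⟧-cong (K.trans (K.*-congʳ (ε-cons k pu))
                                     (K.trans (x∙yz≈y∙xz K.*-commutativeSemigroup _ _ _) (K.*-congˡ (K.*-assoc _ _ _))))) ⟩
    ι (iq K.* (K.signR k K.* (ε u K.* z))) * (p (suc k) * pPart p u)
      ≈⟨ *-congʳ (trans (ι.*-homo _ _) (*-congˡ (trans (ι.*-homo _ _) (*-congʳ (ι-signR k))))) ⟩
    ι iq * (signR k * ι (ε u K.* z)) * (p (suc k) * pPart p u)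
      ≈⟨ trans (*-assoc _ _ _) (*-congˡ (interchange *-commutativeSemigroup _ _ _ _)) ⟩
    ι iq * (pSeries p k * term (m ∸ k) u) ∎
    where
    iq = K.qint q (suc m) K.⁻¹
    z  = zTerm (m ∸ k) u

  expansion-suc : ∀ m → expansion (suc m) ≈ ι (K.qint q (suc m) K.⁻¹) * conv (pSeries p) expansion m
  expansion-suc m = begin
    expansion (suc m)
      ≈⟨ ∑-compositions-suc m (term (suc m)) ⟩
    ∑[ k ∈ upTo (suc m) ] ∑[ u ∈ compositions (m ∸ k) ] term (suc m) (suc k ∷ u)
      ≈⟨ ∑-cong (upTo (suc m)) (λ k →
           trans (∑-congᴬ (All.map (term-cons m k ∘ proj₁) (compositions-sound (m ∸ k))))
                 (sym (trans (*-congˡ (*-distribˡ-∑ _ (term (m ∸ k)) (compositions (m ∸ k))))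
                             (*-distribˡ-∑ iq _ (compositions (m ∸ k)))))) ⟩
    ∑[ k ∈ upTo (suc m) ] (iq * (pSeries p k * expansion (m ∸ k)))
      ≈⟨ *-distribˡ-∑ iq _ (upTo (suc m)) ⟨
    iq * conv (pSeries p) expansion m ∎
    where iq = ι (K.qint q (suc m) K.⁻¹)

  expansion-unique : Transcendental K q → (e : ℕ → Carrier) → e 0 ≈ 1# →
    (∀ m → conv (pSeries p) e m ≈ Dq e m) → ∀ n → e n ≈ expansion n
  expansion-unique q-tr e e₀ D-eq =
    convolution-recursion-unique (pSeries p) (λ m → ι (K.qint q (suc m) K.⁻¹)) e expansion
      (trans e₀ (sym expansion-zero)) e-rec expansion-suc
    where
    e-rec : ∀ m → e (suc m) ≈ ι (K.qint q (suc m) K.⁻¹) * conv (pSeries p) e m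
    e-rec m = begin
      e (suc m)                                          ≈⟨ *-identityˡ _ ⟨
      1# * e (suc m)                                     ≈⟨ *-congʳ (ι-inverse (qint-suc≉0 K q q-tr m)) ⟨
      ι ([m+1] K.⁻¹) * ι [m+1] * e (suc m)               ≈⟨ *-assoc _ _ _ ⟩
      ι ([m+1] K.⁻¹) * Dq e m                            ≈⟨ *-congˡ (D-eq m) ⟨
      ι ([m+1] K.⁻¹) * conv (pSeries p) e m              ∎
      where [m+1] = K.qint q (suc m)

corollary4p4 : ∀ {c ℓ a ℓa : Level}
    (K : Field c ℓ) (q : Field.Carrier K) → Transcendental K q →
    (A : CommutativeRing a ℓa) (ι : Field.Carrier K → CommutativeRing.Carrier A) →
    RingMorphisms.IsRingHomomorphism (CommutativeRing.rawRing (Field.commutativeRing K)) (CommutativeRing.rawRing A) ι →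
    let open CommutativeRing A
        open RingOps A
        open QPartition K q
        open QSeries K q A ι
        module KF = Field K
    in (e : ℕ → Carrier) → e 0 ≈ 1# →
       (p : ℕ → Carrier) → (∀ m → conv (pSeries p) e m ≈ Dq e m) →
       ∀ n → e n ≈ sumR (map (λ lam → ι (ε lam KF.* zInv lam) * pPart p lam) (partitions n))
corollary4p4 K q q-tr A ι ι-hom e e₀ p D-eq n =
  trans (expansion-unique q-tr e e₀ D-eq n) (sym (∑-partitions≈expansion n))
  where
  open CommutativeRing A using (trans; sym)
  open Expansion K q A ι ι-hom p
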